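{- Let $n=2^k+1$ with $k\ge 2$, let $T$ be a tour in the complete graph on $n$ vertices, and let $\mathcal{S}=\bigcup_{t=1}^{\log(n-1)-1}\mathcal{S}_t$ be the set of 2-changes constructed below. Then $\{k_e(\mathcal{S})\}_{e\in T}=\{0,1,2,\dots,n-3\}$ as sets; moreover, there are exactly two edges with $k_e(\mathcal{S})=0$ and two edges with $k_e(\mathcal{S})=\frac{n-1}{2}-1$.
   Context: $\log$ is base 2. A tour is a Hamiltonian cycle; its edges are tour-edges. A 2-change $S_T(e,f)$, for non-adjacent tour-edges $e,f$, removes $e,f$ and adds the unique two non-tour edges reconnecting the result into a tour. For a set $\mathcal{S}$ of 2-changes, $P(\mathcal{S})=\{\{e,f\}: S_T(e,f)\in\mathcal{S}\}$ and $k_e(\mathcal{S})=|\{p\in P(\mathcal{S}): e\in p\}|$. Construction: label the edges of $T$ as $e_1,\dots,e_n$ in traversal order (from an arbitrary start, in an arbitrary direction); $e_j$ is at position $j$. The last edge $e_n$ is never used. At stage $t\in\{1,\dots,\log(n-1)-1\}$, split $e_1,\dots,e_{n-1}$ into $2^t$ consecutive segments $T_1,\dots,T_{2^t}$ of $(n-1)/2^t$ edges each; $\mathcal{S}_t$ is the set of all 2-changes $S_T(e,f)$ with $e\in T_i$ for some odd $i$ and $f$ an edge of $T_{i+1}$ at an even position along $T$. -}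

module Defs where

open import Data.Nat using (ℕ; zero; suc; _+_; _*_; _∸_; _^_; _≤ᵇ_; _≡ᵇ_; _/_; _%_)
open import Data.Nat.Properties using (m^n≢0)
open import Data.Bool using (Bool; true; false; _∧_; _∨_; if_then_else_)
open import Data.List using (List; []; _∷_; map; upTo)
open import Data.Bool.ListAction using (any)

-- Conventions.  n = 2 ^ k + 1.  Tour edges are identified with their
-- positions 1 .. n along the traversal (e_j has position j).  The 2-changes
-- S_T(e,f) are determined by the unordered pair {e,f} of tour-edges, and the
-- only data that matters is positions, so we work with positions.

nV : ℕ → ℕ
nV k = 2 ^ k + 1

-- segment length at stage t : (n-1)/2^t = 2^(k-t)
segLen : ℕ → ℕ → ℕ
segLen k t = 2 ^ (k ∸ t)

-- 0-based index of the segment containing the edge at position p (1 ≤ p ≤ n-1)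
-- at stage t; the 1-based index i is segIdx + 1.
segIdx : ℕ → ℕ → ℕ → ℕ
segIdx k t p = _/_ (p ∸ 1) (segLen k t) {{m^n≢0 2 (k ∸ t)}}

isEven : ℕ → Bool
isEven m = m % 2 ≡ᵇ 0

usedPos : ℕ → ℕ → Bool
usedPos k p = (1 ≤ᵇ p) ∧ (p ≤ᵇ 2 ^ k)

-- stageRel k t a b = true  iff  S_T(e_a, e_b) ∈ S_t, i.e. e_a lies in a
-- segment T_i with i odd and e_b lies in T_{i+1} at an even position.
stageRel : ℕ → ℕ → ℕ → ℕ → Bool
stageRel k t a b =
  usedPos k a ∧ usedPos k b
  ∧ isEven (segIdx k t a)                       -- i = segIdx+1 is odd
  ∧ (segIdx k t b ≡ᵇ suc (segIdx k t a))
  ∧ isEven b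

-- stages t = 1 .. log(n-1) - 1 = 1 .. k-1
stages : ℕ → List ℕ
stages k = map suc (upTo (k ∸ 1))

inP : ℕ → ℕ → ℕ → Bool
inP k a b = any (λ t → stageRel k t a b ∨ stageRel k t b a) (stages k)

positions : ℕ → List ℕ
positions m = map suc (upTo m)

count : (ℕ → Bool) → List ℕ → ℕ
count P [] = 0
count P (x ∷ xs) = if P x then suc (count P xs) else count P xs

-- k_e(S) for e = e_p: the number of pairs in P(S) containing e_p.
-- Each such pair is {e_p, e_b} for a unique position b ≠ p.
kE : ℕ → ℕ → ℕ
kE k p = count (λ b → inP k p b) (positions (nV k))

-- Doubling the tour (k ↦ k + 1) splits e_1 .. e_{n-1} into two halves of N = 2^k edges. Stages
-- 2 .. k of level k + 1 act inside each half exactly as stages 1 .. k - 1 of level k, while stage 1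
-- pairs every edge of the first half with the N/2 even positions of the second half. So k_e grows
-- by N/2 on the first half, by N on the even positions of the second half, and not at all on its
-- odd positions. By induction, with c = 2^(k-1) - 1, the edge at position 2j+1 has k_e = c - j and
-- the one at position 2j+2 has k_e = c + j (0 ≤ j ≤ c), while e_n has k_e = 0. These values are
-- exactly 0 .. 2c = n - 3; 0 is taken at positions 2c+1 and n, and c = (n-1)/2 - 1 at positions 1 and 2.

module Submission where

open import Defs
open import Data.Bool using (Bool; true; false; not; _∧_; _∨_; if_then_else_)
open import Data.Bool.Properties using (∧-assoc; ∨-comm; ∨-identityʳ; ∧-zeroʳ; not-involutive)
open import Data.Bool.ListAction using (any)
open import Data.List using ([]; _∷_; _++_; map; upTo; length)
open import Data.List.Properties using (map-upTo; upTo-∷ʳ; length-upTo)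
open import Data.List.Membership.Propositional using (_∈_)
open import Data.List.Membership.Propositional.Properties using (∈-upTo⁻)
open import Data.List.Relation.Unary.Any using (here; there)
open import Data.Nat using (ℕ; zero; suc; pred; _+_; _*_; _∸_; _^_; _≤_; _<_; z≤n; s≤s; _≡ᵇ_; _/_; _%_; NonZero)
open import Data.Nat.Properties
open import Algebra.Properties.CommutativeSemigroup +-commutativeSemigroup using (interchange; xy∙z≈xz∙y; x∙yz≈xz∙y)
open import Data.Nat.Tactic.RingSolver using (solve-∀)
open import Data.Nat.DivMod using ([m+kn]%n≡m%n; /-congˡ; +-distrib-/-∣ˡ; m*n/n≡m; m<n*o⇒m/o<n)
open import Data.Nat.Divisibility using (divides-refl)
open import Data.Product using (_×_; ∃-syntax; _,_)
open import Data.Sum using (inj₁; inj₂)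
open import Function using (_∘_; mk⇔)
open import Relation.Binary.PropositionalEquality
open import Relation.Nullary.Decidable using (yes; no; dec-true; dec-false; does-⇔)

open ≡-Reasoning

count-map : ∀ P (f : ℕ → ℕ) xs → count P (map f xs) ≡ count (P ∘ f) xs
count-map P f [] = refl
count-map P f (x ∷ xs) with P (f x)
... | true  = cong suc (count-map P f xs)
... | false = count-map P f xs

count-++ : ∀ P xs ys → count P (xs ++ ys) ≡ count P xs + count P ys
count-++ P [] ys = refl
count-++ P (x ∷ xs) ys with P x
... | true  = cong suc (count-++ P xs ys)
... | false = count-++ P xs ys

count-cong : ∀ {P Q} xs → (∀ {x} → x ∈ xs → P x ≡ Q x) → count P xs ≡ count Q xs
count-cong [] _ = refl
count-cong {Q = Q} (x ∷ xs) P≗Q rewrite P≗Q (here refl) =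
  cong (λ n → if Q x then suc n else n) (count-cong xs (P≗Q ∘ there))

count-false : ∀ xs → count (λ _ → false) xs ≡ 0
count-false [] = refl
count-false (x ∷ xs) = count-false xs

count-true : ∀ xs → count (λ _ → true) xs ≡ length xs
count-true [] = refl
count-true (x ∷ xs) = cong suc (count-true xs)

count-upTo-const : ∀ b n → count (λ _ → b) (upTo n) ≡ (if b then n else 0)
count-upTo-const true  n = trans (count-true (upTo n)) (length-upTo n)
count-upTo-const false n = count-false (upTo n)

count-upTo-cong : ∀ {P Q} n → (∀ x → x < n → P x ≡ Q x) → count P (upTo n) ≡ count Q (upTo n)
count-upTo-cong n P≗Q = count-cong (upTo n) (λ x∈ → P≗Q _ (∈-upTo⁻ x∈))

count-upTo-none : ∀ {P} n → (∀ x → x < n → P x ≡ false) → count P (upTo n) ≡ 0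
count-upTo-none n none = trans (count-upTo-cong n none) (count-false (upTo n))

count-upTo-suc : ∀ P n → count P (upTo (suc n)) ≡ count P (upTo n) + count P (n ∷ [])
count-upTo-suc P n = trans (cong (count P) (sym (upTo-∷ʳ n))) (count-++ P (upTo n) (n ∷ []))

count-upTo-+ : ∀ P m n → count P (upTo (m + n)) ≡ count P (upTo m) + count (λ x → P (m + x)) (upTo n)
count-upTo-+ P m zero = trans (cong (count P ∘ upTo) (+-identityʳ m)) (sym (+-identityʳ _))
count-upTo-+ P m (suc n) = begin
  count P (upTo (m + suc n))                                ≡⟨ cong (count P ∘ upTo) (+-suc m n) ⟩
  count P (upTo (suc (m + n)))                              ≡⟨ count-upTo-suc P (m + n) ⟩
  count P (upTo (m + n)) + count Q (n ∷ [])                 ≡⟨ cong (_+ count Q (n ∷ [])) (count-upTo-+ P m n) ⟩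
  count P (upTo m) + count Q (upTo n) + count Q (n ∷ [])    ≡⟨ +-assoc (count P (upTo m)) _ _ ⟩
  count P (upTo m) + (count Q (upTo n) + count Q (n ∷ []))  ≡⟨ cong (count P (upTo m) +_) (count-upTo-suc Q n) ⟨
  count P (upTo m) + count Q (upTo (suc n))                 ∎
  where
  Q : ℕ → Bool
  Q x = P (m + x)

count-upTo-double : ∀ P n →
  count P (upTo (2 * n)) ≡ count (λ j → P (2 * j)) (upTo n) + count (λ j → P (suc (2 * j))) (upTo n)
count-upTo-double P zero = refl
count-upTo-double P (suc n) = begin
  count P (upTo (2 * suc n))                        ≡⟨ cong (count P ∘ upTo) (*-suc 2 n) ⟩
  count P (upTo (suc (suc (2 * n))))                ≡⟨ count-upTo-suc P (suc (2 * n)) ⟩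
  count P (upTo (suc (2 * n))) + count Pₒ (n ∷ [])  ≡⟨ cong (_+ count Pₒ (n ∷ [])) (count-upTo-suc P (2 * n)) ⟩
  count P (upTo (2 * n)) + count Pₑ (n ∷ []) + count Pₒ (n ∷ [])
    ≡⟨ cong (λ s → s + count Pₑ (n ∷ []) + count Pₒ (n ∷ [])) (count-upTo-double P n) ⟩
  count Pₑ (upTo n) + count Pₒ (upTo n) + count Pₑ (n ∷ []) + count Pₒ (n ∷ [])
    ≡⟨ +-assoc (count Pₑ (upTo n) + count Pₒ (upTo n)) _ _ ⟩
  (count Pₑ (upTo n) + count Pₒ (upTo n)) + (count Pₑ (n ∷ []) + count Pₒ (n ∷ []))
    ≡⟨ interchange (count Pₑ (upTo n)) (count Pₒ (upTo n)) (count Pₑ (n ∷ [])) (count Pₒ (n ∷ [])) ⟩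
  (count Pₑ (upTo n) + count Pₑ (n ∷ [])) + (count Pₒ (upTo n) + count Pₒ (n ∷ []))
    ≡⟨ cong₂ _+_ (count-upTo-suc Pₑ n) (count-upTo-suc Pₒ n) ⟨
  count Pₑ (upTo (suc n)) + count Pₒ (upTo (suc n))  ∎
  where
  Pₑ Pₒ : ℕ → Bool
  Pₑ j = P (2 * j)
  Pₒ j = P (suc (2 * j))

count-upTo-≡ᵇ : ∀ {c} n → c < n → count (_≡ᵇ c) (upTo n) ≡ 1
count-upTo-≡ᵇ {c} (suc n) c<1+n with m<1+n⇒m<n∨m≡n c<1+n
... | inj₁ c<n = begin
  count (_≡ᵇ c) (upTo (suc n))                     ≡⟨ count-upTo-suc (_≡ᵇ c) n ⟩
  count (_≡ᵇ c) (upTo n) + count (_≡ᵇ c) (n ∷ [])  ≡⟨ cong₂ _+_ (count-upTo-≡ᵇ n c<n) (cong (λ b → if b then 1 else 0) n≢c) ⟩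
  1                                                ∎
  where
  n≢c : (n ≡ᵇ c) ≡ false
  n≢c = dec-false (n ≟ c) (>⇒≢ c<n)
... | inj₂ refl = begin
  count (_≡ᵇ n) (upTo (suc n))                     ≡⟨ count-upTo-suc (_≡ᵇ n) n ⟩
  count (_≡ᵇ n) (upTo n) + count (_≡ᵇ n) (n ∷ [])  ≡⟨ cong₂ _+_ none (cong (λ b → if b then 1 else 0) (dec-true (n ≟ n) refl)) ⟩
  1                                                ∎
  where
  none : count (_≡ᵇ n) (upTo n) ≡ 0
  none = count-upTo-none n (λ x x<n → dec-false (x ≟ n) (<⇒≢ x<n))

any-map : ∀ f (g : ℕ → ℕ) xs → any f (map g xs) ≡ any (f ∘ g) xs
any-map f g [] = refl
any-map f g (x ∷ xs) = cong (f (g x) ∨_) (any-map f g xs)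

any-cong : ∀ {f g : ℕ → Bool} xs → (∀ {x} → x ∈ xs → f x ≡ g x) → any f xs ≡ any g xs
any-cong [] _ = refl
any-cong (x ∷ xs) f≗g = cong₂ _∨_ (f≗g (here refl)) (any-cong xs (f≗g ∘ there))

any-none : ∀ {f : ℕ → Bool} xs → (∀ {x} → x ∈ xs → f x ≡ false) → any f xs ≡ false
any-none [] _ = refl
any-none (x ∷ xs) none rewrite none (here refl) = any-none xs (none ∘ there)

any-upTo-suc : ∀ f n → any f (upTo (suc n)) ≡ f 0 ∨ any (f ∘ suc) (upTo n)
any-upTo-suc f n = cong (f 0 ∨_) (trans (cong (any f) (sym (map-upTo suc n))) (any-map f suc (upTo n)))

isEven-2*+ : ∀ q r → isEven (2 * q + r) ≡ isEven r
isEven-2*+ q r = cong (_≡ᵇ 0) (begin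
  (2 * q + r) % 2 ≡⟨ cong (_% 2) (trans (+-comm (2 * q) r) (cong (r +_) (*-comm 2 q))) ⟩
  (r + q * 2) % 2 ≡⟨ [m+kn]%n≡m%n r q 2 ⟩
  r % 2           ∎)

isEven-suc : ∀ x → isEven (suc x) ≡ not (isEven x)
isEven-suc zero = refl
isEven-suc (suc x) = begin
  isEven (2 + x)           ≡⟨ isEven-2*+ 1 x ⟩
  isEven x                 ≡⟨ not-involutive (isEven x) ⟨
  not (not (isEven x))     ≡⟨ cong not (isEven-suc x) ⟨
  not (isEven (suc x))     ∎

isEven-2* : ∀ q → isEven (2 * q) ≡ true
isEven-2* q = trans (cong isEven (sym (+-identityʳ (2 * q)))) (isEven-2*+ q 0)

isEven-1+2* : ∀ q → isEven (suc (2 * q)) ≡ false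
isEven-1+2* q = trans (isEven-suc (2 * q)) (cong not (isEven-2* q))

isEven-2+2* : ∀ q → isEven (2 + 2 * q) ≡ true
isEven-2+2* q = trans (isEven-2*+ 1 (2 * q)) (isEven-2* q)

+-cancelˡ-≡ᵇ : ∀ c x y → (c + x ≡ᵇ c + y) ≡ (x ≡ᵇ y)
+-cancelˡ-≡ᵇ zero    x y = refl
+-cancelˡ-≡ᵇ (suc c) x y = +-cancelˡ-≡ᵇ c x y

-- Segment indices are 0-based, so an even i is the odd-numbered segment T_{i+1} of the paper.
feeds : ℕ → ℕ → Bool
feeds i j = isEven i ∧ (j ≡ᵇ suc i)

feeds-shift : ∀ q i j → feeds (2 * q + i) (2 * q + j) ≡ feeds i j
feeds-shift q i j = cong₂ _∧_ (isEven-2*+ q i) (begin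
  (2 * q + j ≡ᵇ suc (2 * q + i)) ≡⟨ cong (2 * q + j ≡ᵇ_) (+-suc (2 * q) i) ⟨
  (2 * q + j ≡ᵇ 2 * q + suc i)   ≡⟨ +-cancelˡ-≡ᵇ (2 * q) j (suc i) ⟩
  (j ≡ᵇ suc i)                   ∎)

feeds-across : ∀ {c i} j → i < c → isEven c ≡ true → feeds i (c + j) ≡ false
feeds-across {c} {i} j i<c c-even with isEven i in i-even
... | false = refl
... | true  = dec-false (c + j ≟ suc i) λ c+j≡1+i →
  let c≡1+i = ≤-antisym (subst (c ≤_) c+j≡1+i (m≤m+n c j)) i<c
  in true≢false (begin
    true                ≡⟨ c-even ⟨
    isEven c            ≡⟨ cong isEven c≡1+i ⟩
    isEven (suc i)      ≡⟨ isEven-suc i ⟩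
    not (isEven i)      ≡⟨ cong not i-even ⟩
    false               ∎)
  where
  true≢false : true ≢ false
  true≢false ()

feeds-backward : ∀ {c i} j → i < c → feeds (c + j) i ≡ false
feeds-backward {c} {i} j i<c =
  trans (cong (isEven (c + j) ∧_) (dec-false (i ≟ suc (c + j)) (<⇒≢ (<-≤-trans i<c (m≤n⇒m≤1+n (m≤m+n c j))))))
        (∧-zeroʳ (isEven (c + j)))

2^-split : ∀ {t k} → t ≤ k → 2 ^ k ≡ 2 ^ t * 2 ^ (k ∸ t)
2^-split {t} {k} t≤k = trans (cong (2 ^_) (sym (m+[n∸m]≡n t≤k))) (^-distribˡ-+-* 2 t (k ∸ t))

segIdx-< : ∀ k {t x} → t ≤ k → x < 2 ^ k → segIdx k t (suc x) < 2 ^ t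
segIdx-< k {t} t≤k x<2^k =
  m<n*o⇒m/o<n {{m^n≢0 2 (k ∸ t)}} (subst (_ <_) (2^-split t≤k) x<2^k)

segIdx-+2^ : ∀ k {t} x → t ≤ k → segIdx k t (suc (2 ^ k + x)) ≡ 2 ^ t + segIdx k t (suc x)
segIdx-+2^ k {t} x t≤k = begin
  (2 ^ k + x) / L         ≡⟨ /-congˡ (cong (_+ x) (2^-split t≤k)) ⟩
  (2 ^ t * L + x) / L     ≡⟨ +-distrib-/-∣ˡ x (divides-refl (2 ^ t)) ⟩
  2 ^ t * L / L + x / L   ≡⟨ cong (_+ x / L) (m*n/n≡m (2 ^ t) L) ⟩
  2 ^ t + x / L           ∎
  where
  L : ℕ
  L = 2 ^ (k ∸ t)
  instance
    L≢0 : NonZero L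
    L≢0 = m^n≢0 2 (k ∸ t)

usedPos-suc : ∀ k {x} → x < 2 ^ k → usedPos k (suc x) ≡ true
usedPos-suc k {x} x<2^k = dec-true (x <? 2 ^ k) x<2^k

usedPos-last : ∀ k → usedPos k (suc (2 ^ k)) ≡ false
usedPos-last k = dec-false (2 ^ k <? 2 ^ k) (n≮n (2 ^ k))

linked : ℕ → ℕ → ℕ → ℕ → Bool
linked k t a b = feeds (segIdx k t a) (segIdx k t b) ∧ isEven b

stageRel-linked : ∀ {k a b} t → usedPos k a ≡ true → usedPos k b ≡ true → stageRel k t a b ≡ linked k t a b
stageRel-linked {k} {a} {b} t a-used b-used rewrite a-used | b-used =
  sym (∧-assoc (isEven (segIdx k t a)) _ (isEven b))

pairedAt : ℕ → ℕ → ℕ → ℕ → Bool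
pairedAt k a b t = stageRel k t a b ∨ stageRel k t b a

pairedAt-linked : ∀ k a b t → usedPos k a ≡ true → usedPos k b ≡ true →
  pairedAt k a b t ≡ linked k t a b ∨ linked k t b a
pairedAt-linked k a b t a-used b-used =
  cong₂ _∨_ (stageRel-linked {k} {a} {b} t a-used b-used) (stageRel-linked {k} {b} {a} t b-used a-used)

inP-sym : ∀ k a b → inP k a b ≡ inP k b a
inP-sym k a b = any-cong {pairedAt k a b} {pairedAt k b a} (stages k) (λ {t} _ → ∨-comm (stageRel k t a b) (stageRel k t b a))

inP-unused : ∀ k a b → usedPos k b ≡ false → inP k a b ≡ false
inP-unused k a b b-unused = any-none (stages k) (λ {t} _ → unpaired t)
  where
  unpaired : ∀ t → pairedAt k a b t ≡ false
  unpaired t rewrite b-unused with usedPos k a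
  ... | true  = refl
  ... | false = refl

inP-suc : ∀ k a b → inP (suc k) a b ≡ any (pairedAt (suc k) a b ∘ suc) (upTo k)
inP-suc k a b = any-map (pairedAt (suc k) a b) suc (upTo k)

inP-suc-suc : ∀ m a b → inP (suc (suc m)) a b ≡
  pairedAt (suc (suc m)) a b 1 ∨ any (λ t → pairedAt (suc (suc m)) a b (suc (suc t))) (upTo m)
inP-suc-suc m a b = trans (inP-suc (suc m) a b) (any-upTo-suc (pairedAt (suc (suc m)) a b ∘ suc) m)

kE-used : ∀ k p → kE k p ≡ count (inP k p ∘ suc) (upTo (2 ^ k))
kE-used k p = begin
  kE k p                                            ≡⟨ count-map (inP k p) suc (upTo (2 ^ k + 1)) ⟩
  count (inP k p ∘ suc) (upTo (2 ^ k + 1))          ≡⟨ cong (count (inP k p ∘ suc) ∘ upTo) (+-comm (2 ^ k) 1) ⟩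
  count (inP k p ∘ suc) (upTo (suc (2 ^ k)))        ≡⟨ count-upTo-suc (inP k p ∘ suc) (2 ^ k) ⟩
  count (inP k p ∘ suc) (upTo (2 ^ k)) + count (inP k p ∘ suc) (2 ^ k ∷ [])
    ≡⟨ cong (λ b → count (inP k p ∘ suc) (upTo (2 ^ k)) + (if b then 1 else 0)) (inP-unused k p (suc (2 ^ k)) (usedPos-last k)) ⟩
  count (inP k p ∘ suc) (upTo (2 ^ k)) + 0          ≡⟨ +-identityʳ _ ⟩
  count (inP k p ∘ suc) (upTo (2 ^ k))              ∎

kE-last : ∀ k → kE k (suc (2 ^ k)) ≡ 0
kE-last k = trans (kE-used k (suc (2 ^ k))) (count-upTo-none (2 ^ k) λ x _ →
  trans (inP-sym k (suc (2 ^ k)) (suc x)) (inP-unused k (suc x) (suc (2 ^ k)) (usedPos-last k)))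

count-even-positions : ∀ n → count (isEven ∘ suc) (upTo (2 * n)) ≡ n
count-even-positions n = begin
  count (isEven ∘ suc) (upTo (2 * n))
    ≡⟨ count-upTo-double (isEven ∘ suc) n ⟩
  count (λ j → isEven (suc (2 * j))) (upTo n) + count (λ j → isEven (2 + 2 * j)) (upTo n)
    ≡⟨ cong₂ _+_ (count-upTo-none n (λ j _ → isEven-1+2* j)) (count-upTo-cong n (λ j _ → isEven-2+2* j)) ⟩
  count (λ _ → true) (upTo n)
    ≡⟨ count-upTo-const true n ⟩
  n ∎

-- Level K = k + 1 as two copies of level k: lower positions suc x and upper positions suc (N + y), x, y < N.
-- Stage suc t of level K has the segment length 2 ^ (k ∸ t) of stage t of level k, so linked K (suc t) is linked k t
-- by definition.
module Doubling (m : ℕ) where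
  k K M N : ℕ
  k = suc m
  K = suc k
  M = 2 ^ m
  N = 2 ^ k

  lower-used : ∀ {x} → x < N → usedPos K (suc x) ≡ true
  lower-used x<N = usedPos-suc K (<-≤-trans x<N (m≤m+n N (N + 0)))

  upper-used : ∀ {y} → y < N → usedPos K (suc (N + y)) ≡ true
  upper-used {y} y<N = usedPos-suc K (+-monoʳ-< N (subst (y <_) (sym (+-identityʳ N)) y<N))

  segIdx₁-lower : ∀ {x} → x < N → segIdx K 1 (suc x) ≡ 0
  segIdx₁-lower x<N = n<1⇒n≡0 (segIdx-< k z≤n x<N)

  segIdx₁-upper : ∀ {y} → y < N → segIdx K 1 (suc (N + y)) ≡ 1
  segIdx₁-upper {y} y<N = trans (segIdx-+2^ k y z≤n) (cong suc (segIdx₁-lower y<N))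

  isEven-upper : ∀ y → isEven (suc (N + y)) ≡ isEven (suc y)
  isEven-upper y = trans (cong isEven (sym (+-suc N y))) (isEven-2*+ M (suc y))

  stage≤k : ∀ {i} → i < m → suc i ≤ k
  stage≤k = m≤n⇒m≤1+n

  linked-lower-upper : ∀ {i x} y → i < m → x < N → linked k (suc i) (suc x) (suc (N + y)) ≡ false
  linked-lower-upper {i} {x} y i<m x<N = begin
    feeds sx (segIdx k (suc i) (suc (N + y))) ∧ isEven (suc (N + y))
      ≡⟨ cong (λ s → feeds sx s ∧ isEven (suc (N + y))) (segIdx-+2^ k y (stage≤k i<m)) ⟩
    feeds sx (2 ^ suc i + segIdx k (suc i) (suc y)) ∧ isEven (suc (N + y))
      ≡⟨ cong (_∧ isEven (suc (N + y))) (feeds-across _ (segIdx-< k (stage≤k i<m) x<N) (isEven-2* (2 ^ i))) ⟩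
    false ∎
    where
    sx : ℕ
    sx = segIdx k (suc i) (suc x)

  linked-upper-lower : ∀ {i x} y → i < m → x < N → linked k (suc i) (suc (N + y)) (suc x) ≡ false
  linked-upper-lower {i} {x} y i<m x<N = cong (_∧ isEven (suc x)) (begin
    feeds (segIdx k (suc i) (suc (N + y))) sx          ≡⟨ cong (λ s → feeds s sx) (segIdx-+2^ k y (stage≤k i<m)) ⟩
    feeds (2 ^ suc i + segIdx k (suc i) (suc y)) sx    ≡⟨ feeds-backward _ (segIdx-< k (stage≤k i<m) x<N) ⟩
    false                                              ∎)
    where
    sx : ℕ
    sx = segIdx k (suc i) (suc x)

  linked-upper-upper : ∀ {i} x y → i < m →
    linked k (suc i) (suc (N + x)) (suc (N + y)) ≡ linked k (suc i) (suc x) (suc y)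
  linked-upper-upper {i} x y i<m = cong₂ _∧_
    (trans (cong₂ feeds (segIdx-+2^ k x (stage≤k i<m)) (segIdx-+2^ k y (stage≤k i<m))) (feeds-shift (2 ^ i) _ _))
    (isEven-upper y)

  inP-lower-lower : ∀ {x y} → x < N → y < N → inP K (suc x) (suc y) ≡ inP k (suc x) (suc y)
  inP-lower-lower {x} {y} x<N y<N = begin
    inP K a b                                                              ≡⟨ inP-suc-suc m a b ⟩
    pairedAt K a b 1 ∨ any (λ t → pairedAt K a b (suc (suc t))) (upTo m)   ≡⟨ cong₂ _∨_ first (any-cong (upTo m) (λ {t} _ → later (suc t))) ⟩
    any (pairedAt k a b ∘ suc) (upTo m)                                    ≡⟨ inP-suc m a b ⟨
    inP k a b                                                              ∎
    where
    a b : ℕ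
    a = suc x
    b = suc y
    first : pairedAt K a b 1 ≡ false
    first = trans (pairedAt-linked K a b 1 (lower-used x<N) (lower-used y<N))
      (cong₂ (λ i j → (feeds i j ∧ isEven b) ∨ (feeds j i ∧ isEven a)) (segIdx₁-lower x<N) (segIdx₁-lower y<N))
    later : ∀ t → pairedAt K a b (suc t) ≡ pairedAt k a b t
    later t = trans (pairedAt-linked K a b (suc t) (lower-used x<N) (lower-used y<N))
      (sym (pairedAt-linked k a b t (usedPos-suc k x<N) (usedPos-suc k y<N)))

  inP-lower-upper : ∀ {x y} → x < N → y < N → inP K (suc x) (suc (N + y)) ≡ isEven (suc y)
  inP-lower-upper {x} {y} x<N y<N = begin
    inP K a b                                                              ≡⟨ inP-suc-suc m a b ⟩
    pairedAt K a b 1 ∨ any (λ t → pairedAt K a b (suc (suc t))) (upTo m)   ≡⟨ cong₂ _∨_ first (any-none (upTo m) (later ∘ ∈-upTo⁻)) ⟩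
    isEven (suc y) ∨ false                                                 ≡⟨ ∨-identityʳ _ ⟩
    isEven (suc y)                                                         ∎
    where
    a b : ℕ
    a = suc x
    b = suc (N + y)
    first : pairedAt K a b 1 ≡ isEven (suc y)
    first = begin
      pairedAt K a b 1                 ≡⟨ pairedAt-linked K a b 1 (lower-used x<N) (upper-used y<N) ⟩
      linked K 1 a b ∨ linked K 1 b a  ≡⟨ cong₂ (λ i j → (feeds i j ∧ isEven b) ∨ (feeds j i ∧ isEven a)) (segIdx₁-lower x<N) (segIdx₁-upper y<N) ⟩
      isEven b ∨ false                 ≡⟨ ∨-identityʳ _ ⟩
      isEven b                         ≡⟨ isEven-upper y ⟩
      isEven (suc y)                   ∎
    later : ∀ {i} → i < m → pairedAt K a b (suc (suc i)) ≡ false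
    later {i} i<m = trans (pairedAt-linked K a b (suc (suc i)) (lower-used x<N) (upper-used y<N))
      (cong₂ _∨_ (linked-lower-upper y i<m x<N) (linked-upper-lower y i<m x<N))

  inP-upper-upper : ∀ {x y} → x < N → y < N → inP K (suc (N + x)) (suc (N + y)) ≡ inP k (suc x) (suc y)
  inP-upper-upper {x} {y} x<N y<N = begin
    inP K A B                                                              ≡⟨ inP-suc-suc m A B ⟩
    pairedAt K A B 1 ∨ any (λ t → pairedAt K A B (suc (suc t))) (upTo m)   ≡⟨ cong₂ _∨_ first (any-cong (upTo m) (later ∘ ∈-upTo⁻)) ⟩
    any (pairedAt k a b ∘ suc) (upTo m)                                    ≡⟨ inP-suc m a b ⟨
    inP k a b                                                              ∎
    where
    a b A B : ℕ
    a = suc x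
    b = suc y
    A = suc (N + x)
    B = suc (N + y)
    first : pairedAt K A B 1 ≡ false
    first = trans (pairedAt-linked K A B 1 (upper-used x<N) (upper-used y<N))
      (cong₂ (λ i j → (feeds i j ∧ isEven B) ∨ (feeds j i ∧ isEven A)) (segIdx₁-upper x<N) (segIdx₁-upper y<N))
    later : ∀ {i} → i < m → pairedAt K A B (suc (suc i)) ≡ pairedAt k a b (suc i)
    later {i} i<m = begin
      pairedAt K A B (suc (suc i))                         ≡⟨ pairedAt-linked K A B (suc (suc i)) (upper-used x<N) (upper-used y<N) ⟩
      linked k (suc i) A B ∨ linked k (suc i) B A          ≡⟨ cong₂ _∨_ (linked-upper-upper x y i<m) (linked-upper-upper y x i<m) ⟩
      linked k (suc i) a b ∨ linked k (suc i) b a          ≡⟨ pairedAt-linked k a b (suc i) (usedPos-suc k x<N) (usedPos-suc k y<N) ⟨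
      pairedAt k a b (suc i)                               ∎

  kE-halves : ∀ p → kE K p ≡ count (inP K p ∘ suc) (upTo N) + count (λ y → inP K p (suc (N + y))) (upTo N)
  kE-halves p = begin
    kE K p                                         ≡⟨ kE-used K p ⟩
    count (inP K p ∘ suc) (upTo (N + (N + 0)))     ≡⟨ count-upTo-+ (inP K p ∘ suc) N (N + 0) ⟩
    count (inP K p ∘ suc) (upTo N) + count upper (upTo (N + 0))
      ≡⟨ cong (λ n → count (inP K p ∘ suc) (upTo N) + count upper (upTo n)) (+-identityʳ N) ⟩
    count (inP K p ∘ suc) (upTo N) + count upper (upTo N) ∎
    where
    upper : ℕ → Bool
    upper y = inP K p (suc (N + y))

  kE-lower : ∀ {x} → x < N → kE K (suc x) ≡ kE k (suc x) + M
  kE-lower {x} x<N = begin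
    kE K (suc x)
      ≡⟨ kE-halves (suc x) ⟩
    count (inP K (suc x) ∘ suc) (upTo N) + count (λ y → inP K (suc x) (suc (N + y))) (upTo N)
      ≡⟨ cong₂ _+_ (count-upTo-cong N (λ y y<N → inP-lower-lower x<N y<N))
                   (count-upTo-cong N (λ y y<N → inP-lower-upper x<N y<N)) ⟩
    count (inP k (suc x) ∘ suc) (upTo N) + count (isEven ∘ suc) (upTo N)
      ≡⟨ cong₂ _+_ (sym (kE-used k (suc x))) (count-even-positions M) ⟩
    kE k (suc x) + M ∎

  kE-upper : ∀ {y} → y < N → kE K (suc (N + y)) ≡ (if isEven (suc y) then N else 0) + kE k (suc y)
  kE-upper {y} y<N = begin
    kE K b
      ≡⟨ kE-halves b ⟩
    count (inP K b ∘ suc) (upTo N) + count (λ z → inP K b (suc (N + z))) (upTo N)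
      ≡⟨ cong₂ _+_ (count-upTo-cong N (λ x x<N → trans (inP-sym K b (suc x)) (inP-lower-upper x<N y<N)))
                   (count-upTo-cong N (λ z z<N → inP-upper-upper y<N z<N)) ⟩
    count (λ _ → isEven (suc y)) (upTo N) + count (inP k (suc y) ∘ suc) (upTo N)
      ≡⟨ cong₂ _+_ (count-upTo-const (isEven (suc y)) N) (sym (kE-used k (suc y))) ⟩
    (if isEven (suc y) then N else 0) + kE k (suc y) ∎
    where
    b : ℕ
    b = suc (N + y)

data HalfView (M : ℕ) : ℕ → Set where
  lower : ∀ {j} → j < M → HalfView M j
  upper : ∀ {j} → j < M → HalfView M (M + j)

halfView : ∀ M {j} → j < 2 * M → HalfView M j
halfView M {j} j<2M with j <? M
... | yes j<M = lower j<M
... | no  j≮M = subst (HalfView M) M+[j∸M]≡j (upper (+-cancelˡ-< M (j ∸ M) M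
        (subst₂ _<_ (sym M+[j∸M]≡j) (cong (M +_) (+-identityʳ M)) j<2M)))
  where
  M+[j∸M]≡j : M + (j ∸ M) ≡ j
  M+[j∸M]≡j = m+[n∸m]≡n (≮⇒≥ j≮M)

pred-2^-suc : ∀ m → pred (2 ^ suc m) ≡ pred (2 ^ m) + 2 ^ m
pred-2^-suc m = begin
  pred (M + (M + 0))             ≡⟨ cong (λ z → pred (z + (M + 0))) (suc-pred M {{m^n≢0 2 m}}) ⟨
  pred M + (M + 0)               ≡⟨ cong (pred M +_) (+-identityʳ M) ⟩
  pred M + M                     ∎
  where
  M : ℕ
  M = 2 ^ m

m<n⇒1+2m<2n : ∀ {j n} → j < n → suc (2 * j) < 2 * n
m<n⇒1+2m<2n {j} {n} j<n = subst (_≤ 2 * n) (*-suc 2 j) (*-monoʳ-≤ 2 j<n)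

kE-odd : ∀ m {j} → j < 2 ^ m → kE (suc m) (suc (2 * j)) + j ≡ pred (2 ^ m)
kE-odd zero {zero}  _ = refl
kE-odd zero {suc _} (s≤s ())
kE-odd (suc m) j<N with halfView (2 ^ m) j<N
... | lower {j} j<M = begin
  kE K (suc (2 * j)) + j           ≡⟨ cong (_+ j) (kE-lower (*-monoʳ-< 2 j<M)) ⟩
  kE k (suc (2 * j)) + M + j       ≡⟨ xy∙z≈xz∙y (kE k (suc (2 * j))) M j ⟩
  kE k (suc (2 * j)) + j + M       ≡⟨ cong (_+ M) (kE-odd m j<M) ⟩
  pred M + M                       ≡⟨ pred-2^-suc m ⟨
  pred N                           ∎
  where open Doubling m
... | upper {j} j<M = begin
  kE K (suc (2 * (M + j))) + (M + j)
    ≡⟨ cong (λ z → kE K (suc z) + (M + j)) (*-distribˡ-+ 2 M j) ⟩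
  kE K (suc (N + 2 * j)) + (M + j)
    ≡⟨ cong (_+ (M + j)) (kE-upper (*-monoʳ-< 2 j<M)) ⟩
  (if isEven (suc (2 * j)) then N else 0) + kE k (suc (2 * j)) + (M + j)
    ≡⟨ cong (λ b → (if b then N else 0) + kE k (suc (2 * j)) + (M + j)) (isEven-1+2* j) ⟩
  kE k (suc (2 * j)) + (M + j)     ≡⟨ x∙yz≈xz∙y (kE k (suc (2 * j))) M j ⟩
  kE k (suc (2 * j)) + j + M       ≡⟨ cong (_+ M) (kE-odd m j<M) ⟩
  pred M + M                       ≡⟨ pred-2^-suc m ⟨
  pred N                           ∎
  where open Doubling m

kE-even : ∀ m {j} → j < 2 ^ m → kE (suc m) (2 + 2 * j) ≡ pred (2 ^ m) + j
kE-even zero {zero}  _ = refl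
kE-even zero {suc _} (s≤s ())
kE-even (suc m) j<N with halfView (2 ^ m) j<N
... | lower {j} j<M = begin
  kE K (2 + 2 * j)                 ≡⟨ kE-lower (m<n⇒1+2m<2n j<M) ⟩
  kE k (2 + 2 * j) + M             ≡⟨ cong (_+ M) (kE-even m j<M) ⟩
  pred M + j + M                   ≡⟨ xy∙z≈xz∙y (pred M) j M ⟩
  pred M + M + j                   ≡⟨ cong (_+ j) (pred-2^-suc m) ⟨
  pred N + j                       ∎
  where open Doubling m
... | upper {j} j<M = begin
  kE K (2 + 2 * (M + j))
    ≡⟨ cong (λ z → kE K (2 + z)) (*-distribˡ-+ 2 M j) ⟩
  kE K (2 + (N + 2 * j))
    ≡⟨ cong (kE K ∘ suc) (+-suc N (2 * j)) ⟨
  kE K (suc (N + suc (2 * j)))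
    ≡⟨ kE-upper (m<n⇒1+2m<2n j<M) ⟩
  (if isEven (2 + 2 * j) then N else 0) + kE k (2 + 2 * j)
    ≡⟨ cong₂ (λ b v → (if b then N else 0) + v) (isEven-2+2* j) (kE-even m j<M) ⟩
  (M + (M + 0)) + (pred M + j)     ≡⟨ cong (_+ (pred M + j)) (cong (M +_) (+-identityʳ M)) ⟩
  (M + M) + (pred M + j)           ≡⟨ interchange M M (pred M) j ⟩
  (M + pred M) + (M + j)           ≡⟨ cong (_+ (M + j)) (+-comm M (pred M)) ⟩
  (pred M + M) + (M + j)           ≡⟨ cong (_+ (M + j)) (pred-2^-suc m) ⟨
  pred N + (M + j)                 ∎
  where open Doubling m

+-cancel-≡ᵇ : ∀ a b a′ b′ → a + b ≡ a′ + b′ → (a ≡ᵇ a′) ≡ (b ≡ᵇ b′)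
+-cancel-≡ᵇ a b a′ b′ eq = does-⇔ (mk⇔
  (λ a≡a′ → +-cancelˡ-≡ a′ b b′ (subst (λ x → x + b ≡ a′ + b′) a≡a′ eq))
  (λ b≡b′ → +-cancelʳ-≡ b′ a a′ (subst (λ x → a + x ≡ a′ + b′) b≡b′ eq)))
  (a ≟ a′) (b ≟ b′)

data ParityView : ℕ → Set where
  even : ∀ j → ParityView (2 * j)
  odd  : ∀ j → ParityView (suc (2 * j))

parityView : ∀ n → ParityView n
parityView zero = even 0
parityView (suc n) with parityView n
... | even j = odd j
... | odd  j = subst ParityView (*-suc 2 j) (even (suc j))

data PositionView (M : ℕ) : ℕ → Set where
  odd  : ∀ {j} → j < M → PositionView M (suc (2 * j))
  even : ∀ {j} → j < M → PositionView M (2 + 2 * j)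
  last : PositionView M (suc (2 * M))

positionView : ∀ M {p} → 1 ≤ p → p ≤ suc (2 * M) → PositionView M p
positionView M {suc x} _ (s≤s x≤2M) with m≤n⇒m<n∨m≡n x≤2M
... | inj₂ refl = last
... | inj₁ x<2M with parityView x
...   | even j = odd (*-cancelˡ-< 2 j M x<2M)
...   | odd  j = even (*-cancelˡ-< 2 j M (<-trans (n<1+n (2 * j)) x<2M))

count-positions : ∀ P n → count P (positions (suc (2 * n))) ≡
  count (λ j → P (suc (2 * j))) (upTo n) + count (λ j → P (2 + 2 * j)) (upTo n) + count P (suc (2 * n) ∷ [])
count-positions P n = begin
  count P (positions (suc (2 * n)))                            ≡⟨ count-map P suc (upTo (suc (2 * n))) ⟩
  count (P ∘ suc) (upTo (suc (2 * n)))                         ≡⟨ count-upTo-suc (P ∘ suc) (2 * n) ⟩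
  count (P ∘ suc) (upTo (2 * n)) + count P (suc (2 * n) ∷ [])  ≡⟨ cong (_+ count P (suc (2 * n) ∷ [])) (count-upTo-double (P ∘ suc) n) ⟩
  count (λ j → P (suc (2 * j))) (upTo n) + count (λ j → P (2 + 2 * j)) (upTo n) + count P (suc (2 * n) ∷ []) ∎

module Values (m : ℕ) where
  k M c : ℕ
  k = suc m
  M = 2 ^ m
  c = pred M

  instance
    M≢0 : NonZero M
    M≢0 = m^n≢0 2 m

  ≤c⇒<M : ∀ {j} → j ≤ c → j < M
  ≤c⇒<M = m≤pred[n]⇒suc[m]≤n

  positions-nV : positions (nV k) ≡ positions (suc (2 * M))
  positions-nV = cong positions (+-comm (2 * M) 1)

  nV∸3 : nV k ∸ 3 ≡ c + c
  nV∸3 = begin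
    2 * M + 1 ∸ 3        ≡⟨ cong (λ z → 2 * z + 1 ∸ 3) (suc-pred M) ⟨
    2 * suc c + 1 ∸ 3    ≡⟨ cong (_∸ 3) (double-suc+1 c) ⟩
    c + c + 3 ∸ 3        ≡⟨ m+n∸n≡m (c + c) 3 ⟩
    c + c                ∎
    where
    double-suc+1 : ∀ c → 2 * suc c + 1 ≡ c + c + 3
    double-suc+1 = solve-∀

  nV-middle : (nV k ∸ 1) / 2 ∸ 1 ≡ c
  nV-middle = begin
    (2 * M + 1 ∸ 1) / 2 ∸ 1   ≡⟨ cong (λ z → z / 2 ∸ 1) (m+n∸n≡m (2 * M) 1) ⟩
    2 * M / 2 ∸ 1             ≡⟨ cong (λ z → z / 2 ∸ 1) (*-comm 2 M) ⟩
    M * 2 / 2 ∸ 1             ≡⟨ cong (_∸ 1) (m*n/n≡m M 2) ⟩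
    M ∸ 1                     ∎

  kE-bounded : ∀ p → 1 ≤ p → p ≤ nV k → kE k p ≤ nV k ∸ 3
  kE-bounded p 1≤p p≤nV = subst (kE k p ≤_) (sym nV∸3)
    (bound (positionView M 1≤p (subst (p ≤_) (+-comm (2 * M) 1) p≤nV)))
    where
    bound : ∀ {p} → PositionView M p → kE k p ≤ c + c
    bound (odd {j} j<M) = ≤-trans (m≤m+n _ j) (≤-trans (≤-reflexive (kE-odd m j<M)) (m≤m+n c c))
    bound (even j<M)    = ≤-trans (≤-reflexive (kE-even m j<M)) (+-monoʳ-≤ c (<⇒≤pred j<M))
    bound last          = subst (_≤ c + c) (sym (kE-last k)) z≤n

  kE-onto : ∀ v → v ≤ nV k ∸ 3 → ∃[ p ] (1 ≤ p × p ≤ nV k × kE k p ≡ v)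
  kE-onto v v≤nV∸3 with v ≤? c
  ... | yes v≤c = suc (2 * j) , s≤s z≤n , ≤-trans (<⇒≤ (m<n⇒1+2m<2n j<M)) (m≤m+n (2 * M) 1) ,
        +-cancelʳ-≡ j _ v (trans (kE-odd m j<M) (sym (m+[n∸m]≡n v≤c)))
    where
    j : ℕ
    j = c ∸ v
    j<M : j < M
    j<M = ≤c⇒<M (m∸n≤m c v)
  ... | no v≰c = 2 + 2 * j , s≤s z≤n , ≤-trans (m<n⇒1+2m<2n j<M) (m≤m+n (2 * M) 1) ,
        trans (kE-even m j<M) (m+[n∸m]≡n (<⇒≤ (≰⇒> v≰c)))
    where
    j : ℕ
    j = v ∸ c
    j<M : j < M
    j<M = ≤c⇒<M (m≤n+o⇒m∸n≤o v c (subst (v ≤_) nV∸3 v≤nV∸3))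

  count-kE≡ : ∀ v → count (λ p → kE k p ≡ᵇ v) (positions (nV k)) ≡
    count (λ j → kE k (suc (2 * j)) ≡ᵇ v) (upTo M) + count (λ j → kE k (2 + 2 * j) ≡ᵇ v) (upTo M)
      + (if 0 ≡ᵇ v then 1 else 0)
  count-kE≡ v = begin
    count V (positions (nV k))               ≡⟨ cong (count V) positions-nV ⟩
    count V (positions (suc (2 * M)))        ≡⟨ count-positions V M ⟩
    Odd + Even + count V (suc (2 * M) ∷ [])  ≡⟨ cong (λ e → Odd + Even + (if e ≡ᵇ v then 1 else 0)) (kE-last k) ⟩
    Odd + Even + (if 0 ≡ᵇ v then 1 else 0)   ∎
    where
    V : ℕ → Bool
    V p = kE k p ≡ᵇ v
    Odd Even : ℕ
    Odd = count (λ j → kE k (suc (2 * j)) ≡ᵇ v) (upTo M)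
    Even = count (λ j → kE k (2 + 2 * j) ≡ᵇ v) (upTo M)

  count-kE≡0 : 1 ≤ c → count (λ p → kE k p ≡ᵇ 0) (positions (nV k)) ≡ 2
  count-kE≡0 1≤c = trans (count-kE≡ 0) (cong (_+ 1) (cong₂ _+_ odds evens))
    where
    odds : count (λ j → kE k (suc (2 * j)) ≡ᵇ 0) (upTo M) ≡ 1
    odds = trans (count-upTo-cong M (λ j j<M → +-cancel-≡ᵇ _ j 0 c (kE-odd m j<M)))
                 (count-upTo-≡ᵇ M (≤c⇒<M ≤-refl))
    evens : count (λ j → kE k (2 + 2 * j) ≡ᵇ 0) (upTo M) ≡ 0
    evens = count-upTo-none M (λ j j<M → dec-false (_ ≟ 0) λ kE≡0 →
      <⇒≢ (≤-trans 1≤c (m≤m+n c j)) (trans (sym kE≡0) (kE-even m j<M)))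

  count-kE≡c : 1 ≤ c → count (λ p → kE k p ≡ᵇ c) (positions (nV k)) ≡ 2
  count-kE≡c 1≤c = trans (count-kE≡ c) (cong₂ _+_ (cong₂ _+_ odds evens) lastPos)
    where
    odds : count (λ j → kE k (suc (2 * j)) ≡ᵇ c) (upTo M) ≡ 1
    odds = trans (count-upTo-cong M (λ j j<M → +-cancel-≡ᵇ _ j c 0 (trans (kE-odd m j<M) (sym (+-identityʳ c)))))
                 (count-upTo-≡ᵇ M (≤c⇒<M z≤n))
    evens : count (λ j → kE k (2 + 2 * j) ≡ᵇ c) (upTo M) ≡ 1
    evens = trans (count-upTo-cong M (λ j j<M →
                    trans (cong₂ _≡ᵇ_ (kE-even m j<M) (sym (+-identityʳ c))) (+-cancelˡ-≡ᵇ c j 0)))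
                  (count-upTo-≡ᵇ M (≤c⇒<M z≤n))
    lastPos : (if 0 ≡ᵇ c then 1 else 0) ≡ 0
    lastPos = cong (λ b → if b then 1 else 0) (dec-false (0 ≟ c) (<⇒≢ 1≤c))

lemma13 : (k : ℕ) → 2 ≤ k →
    ((p : ℕ) → 1 ≤ p → p ≤ nV k → kE k p ≤ nV k ∸ 3)
    × ((m : ℕ) → m ≤ nV k ∸ 3 → ∃[ p ] (1 ≤ p × p ≤ nV k × kE k p ≡ m))
    × (count (λ p → kE k p ≡ᵇ 0) (positions (nV k)) ≡ 2)
    × (count (λ p → kE k p ≡ᵇ ((nV k ∸ 1) / 2 ∸ 1)) (positions (nV k)) ≡ 2)
lemma13 (suc (suc m)) _ =
  kE-bounded , kE-onto , count-kE≡0 1≤c ,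
  subst (λ v → count (λ p → kE k p ≡ᵇ v) (positions (nV k)) ≡ 2) (sym nV-middle) (count-kE≡c 1≤c)
  where
  open Values (suc m)
  1≤c : 1 ≤ c
  1≤c = suc[m]≤n⇒m≤pred[n] (*-monoʳ-≤ 2 (m^n>0 2 m))
lemma13 1 (s≤s ())
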